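{- Let $m\geq 2$, $r$ and $s$ be positive integers with $s\geq 2r(m-1)+1$, let $I_2=[r(m-1)+2,\,2r(m-1)]$ and $I_3=[2r(m-1)+1,\,s]$, and let $\Delta:[1,s]\to[1,r]$ be a coloring. If there exists an $m$-set $Y=(y_1,\ldots,y_m)$ with $Y\subset I_2\cup I_3$, $Y$ monochromatic under $\Delta$, and $y_m\in I_3$, then $\Delta$ is not an $L(r)$-coloring (with respect to $m$).
   Context: For integers $a,b$, $[a,b]$ denotes the set of integers $i$ with $a\le i\le b$. An $m$-set $Z=(z_1,\ldots,z_m)$ is a set of $m$ positive integers listed increasingly, $z_1<\cdots<z_m$. For $m$-sets $X,Y$, write $X\prec Y$ if $x_m<y_1$. A set $T$ is monochromatic under a coloring $\Delta$ if $\Delta$ is constant on $T$. Given $m$ and $r$, an $r$-coloring $\Delta:S\to[1,r]$ of a nonempty set $S$ of integers is an $L(r)$-coloring if there do not exist monochromatic $m$-sets $X,Y\subset S$ with $X\prec Y$ and $2(x_m-x_1)\leq y_m-x_1$. -}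

module Defs where

open import Data.Nat using (ℕ; zero; suc; _+_; _*_; _∸_; _≤_; _<_)
open import Data.Fin using (Fin; fromℕ; toℕ) renaming (zero to fzero)
open import Data.Product using (Σ; _×_; ∃)
open import Relation.Nullary using (¬_)
open import Relation.Binary.PropositionalEquality using (_≡_)

_∈[_,_] : ℕ → ℕ → ℕ → Set
x ∈[ a , b ] = a ≤ x × x ≤ b

IsMSet : (m : ℕ) → (Fin m → ℕ) → Set
IsMSet m z = (∀ i → 1 ≤ z i) × (∀ i j → toℕ i < toℕ j → z i < z j)

-- first element z_1 and last element z_m (m = 0 gives the default 0, never used)
first : (m : ℕ) → (Fin m → ℕ) → ℕ
first zero    z = 0
first (suc n) z = z fzero

last : (m : ℕ) → (Fin m → ℕ) → ℕ
last zero    z = 0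
last (suc n) z = z (fromℕ n)

SubsetOf : (m : ℕ) → (Fin m → ℕ) → (ℕ → Set) → Set
SubsetOf m z P = ∀ i → P (z i)

Monochromatic : (m : ℕ) → (ℕ → ℕ) → (Fin m → ℕ) → Set
Monochromatic m Δ z = ∀ i j → Δ (z i) ≡ Δ (z j)

_≺⟨_⟩_ : {m' : ℕ} → (Fin m' → ℕ) → (m : ℕ) → (Fin m → ℕ) → Set
_≺⟨_⟩_ {m'} x m y = last m' x < first m y

IsColoring : (r : ℕ) → (S : ℕ → Set) → (ℕ → ℕ) → Set
IsColoring r S Δ = ∀ x → S x → Δ x ∈[ 1 , r ]

-- L(r)-coloring condition (w.r.t. m) of Δ on S: there are no monochromatic
-- m-sets X, Y ⊂ S with X ≺ Y and 2(x_m - x_1) ≤ y_m - x_1.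
-- (All values are naturals; since X ≺ Y, y_m - x_1 is a genuine difference.)
IsLColoring : (m r : ℕ) → (S : ℕ → Set) → (ℕ → ℕ) → Set
IsLColoring m r S Δ =
  IsColoring r S Δ ×
  ¬ (Σ (Fin m → ℕ) λ X → Σ (Fin m → ℕ) λ Y →
       IsMSet m X × IsMSet m Y ×
       SubsetOf m X S × SubsetOf m Y S ×
       Monochromatic m Δ X × Monochromatic m Δ Y ×
       (_≺⟨_⟩_ {m} X m Y) ×
       2 * (last m X ∸ first m X) ≤ last m Y ∸ first m X)

{-# OPTIONS --safe #-}
-- Write t = r(m − 1). The segment [1, t + 1] has more than r(m − 1) elements and only r
-- colours, so by pigeonhole it contains a monochromatic m-set X. Every element of I₂ ∪ I₃
-- is at least t + 2 > x_m, so X ≺ Y; and since x_m ≤ t + 1, x_1 ≥ 1 and y_m ≥ 2t + 1,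
-- we get 2 x_m ≤ y_m + x_1, i.e. 2(x_m − x_1) ≤ y_m − x_1. X and Y need not share a colour.
module Submission where

open import Defs
open import Data.Nat using (ℕ; suc; _+_; _*_; _∸_; _≤_; _<_)
open import Data.Fin using (Fin)
open import Data.Product using (Σ; _×_)
open import Data.Sum using (_⊎_)
open import Relation.Nullary using (¬_)

open import Data.Nat using (zero; z≤n; s≤s; _≟_; _<?_)
open import Data.Nat.Properties
open import Data.Nat.Solver using (module +-*-Solver)
open import Data.Fin using (toℕ; fromℕ; inject≤) renaming (zero to fzero; suc to fsuc)
open import Data.Fin.Properties using (toℕ-inject≤)
open import Data.Product as Σ using (_,_; ∃-syntax)
open import Data.Sum using (inj₁; inj₂; [_,_]′)
open import Data.List using (List; []; _∷_; length; filter; lookup; applyUpTo)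
open import Data.List.Properties using (length-applyUpTo)
open import Data.List.Membership.Propositional.Properties using (∈-lookup)
open import Data.List.Relation.Binary.Sublist.Propositional.Properties using (filter-⊆; filter⁺; length-mono-≤)
open import Data.List.Relation.Unary.All as All using (All; _∷_)
import Data.List.Relation.Unary.All.Properties as Allₚ
open import Data.List.Relation.Unary.AllPairs using (AllPairs; _∷_)
import Data.List.Relation.Unary.AllPairs.Properties as AllPairsₚ
open import Function using (_∘_)
open import Relation.Nullary using (¬?; yes; no; contradiction)
open import Relation.Unary using (Pred; Decidable)
open import Relation.Binary.PropositionalEquality using (_≡_; refl; sym; trans; cong; subst; subst₂)

module _ {a p} {A : Set a} {P : Pred A p} (P? : Decidable P) where

  length-filter-+-¬ : ∀ xs → length (filter P? xs) + length (filter (¬? ∘ P?) xs) ≡ length xs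
  length-filter-+-¬ []       = refl
  length-filter-+-¬ (x ∷ xs) with P? x
  ... | yes _ = cong suc (length-filter-+-¬ xs)
  ... | no  _ = trans (+-suc _ _) (cong suc (length-filter-+-¬ xs))

AllPairs-lookup : ∀ {A : Set} {R : A → A → Set} {xs : List A} → AllPairs R xs →
                  ∀ {i j} → toℕ i < toℕ j → R (lookup xs i) (lookup xs j)
AllPairs-lookup {xs = _ ∷ _} (x∼xs ∷ _)  {fzero}  {fsuc j} _         = All.lookup x∼xs (∈-lookup j)
AllPairs-lookup {xs = _ ∷ _} (_ ∷ xs-ok) {fsuc i} {fsuc j} (s≤s i<j) = AllPairs-lookup xs-ok i<j

module _ {A : Set} (Δ : A → ℕ) where

  colourClass : ℕ → List A → List A
  colourClass c = filter (λ x → Δ x ≟ c)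

  pigeonhole : ∀ r k xs → All (λ x → Δ x ∈[ 1 , r ]) xs → r * k < length xs →
               ∃[ c ] k < length (colourClass c xs)
  pigeonhole zero    k (_ ∷ _) ((1≤Δx , Δx≤0) ∷ _) _ = contradiction (≤-trans 1≤Δx Δx≤0) λ ()
  pigeonhole (suc r) k xs colours long with k <? length (colourClass (suc r) xs)
  ... | yes big  = suc r , big
  ... | no small =
    Σ.map₂ (λ big → <-≤-trans big (class-shrinks _)) (pigeonhole r k others others-colours others-long)
    where
      others : List A
      others = filter (λ x → ¬? (Δ x ≟ suc r)) xs

      others-colours : All (λ x → Δ x ∈[ 1 , r ]) others
      others-colours = All.zipWith
        (λ { ((1≤Δx , Δx≤1+r) , Δx≢1+r) → 1≤Δx , ≤-pred (≤∧≢⇒< Δx≤1+r Δx≢1+r) })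
        (Allₚ.filter⁺ _ colours , Allₚ.all-filter _ xs)

      others-long : r * k < length others
      others-long = +-cancelˡ-< k _ _ (begin-strict
        k + r * k                                       <⟨ long ⟩
        length xs                                       ≡⟨ sym (length-filter-+-¬ _ xs) ⟩
        length (colourClass (suc r) xs) + length others ≤⟨ +-monoˡ-≤ _ (≮⇒≥ small) ⟩
        k + length others                               ∎)
        where open ≤-Reasoning

      class-shrinks : ∀ c → length (colourClass c others) ≤ length (colourClass c xs)
      class-shrinks c = length-mono-≤ (filter⁺ _ _ (λ { refl Δx≡c → Δx≡c }) (filter-⊆ _ xs))

monochromatic-mset : ∀ r k (Δ : ℕ → ℕ) → IsColoring r (_∈[ 1 , r * k + 1 ]) Δ →
  Σ (Fin (suc k) → ℕ) λ X →
    IsMSet (suc k) X × SubsetOf (suc k) X (_∈[ 1 , r * k + 1 ]) × Monochromatic (suc k) Δ X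
monochromatic-mset r k Δ colouring = X , (X-positive , X-increasing) , X-bounded , X-mono
  where
    n : ℕ
    n = r * k + 1

    segment : List ℕ
    segment = applyUpTo suc n

    in-segment : All (_∈[ 1 , n ]) segment
    in-segment = Allₚ.applyUpTo⁺₁ suc n (λ i<n → s≤s z≤n , i<n)

    segment-long : r * k < length segment
    segment-long = subst (r * k <_) (sym (length-applyUpTo suc n)) (m<m+n (r * k) (s≤s z≤n))

    class = pigeonhole Δ r k segment (All.map (colouring _) in-segment) segment-long
    c     = Σ.proj₁ class
    ys    = colourClass Δ c segment

    X : Fin (suc k) → ℕ
    X i = lookup ys (inject≤ i (Σ.proj₂ class))

    X∈ys : ∀ {Q : ℕ → Set} → All Q ys → ∀ i → Q (X i)
    X∈ys Q-ys i = All.lookup Q-ys (∈-lookup _)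

    X-bounded : ∀ i → X i ∈[ 1 , n ]
    X-bounded = X∈ys (Allₚ.filter⁺ _ in-segment)

    X-positive : ∀ i → 1 ≤ X i
    X-positive = Σ.proj₁ ∘ X-bounded

    X-increasing : ∀ i j → toℕ i < toℕ j → X i < X j
    X-increasing i j i<j = AllPairs-lookup (AllPairsₚ.filter⁺ _ segment-increasing)
      (subst₂ _<_ (sym (toℕ-inject≤ i _)) (sym (toℕ-inject≤ j _)) i<j)
      where
        segment-increasing : AllPairs _<_ segment
        segment-increasing = AllPairsₚ.applyUpTo⁺₁ suc n (λ i<j _ → s≤s i<j)

    X-mono : ∀ i j → Δ (X i) ≡ Δ (X j)
    X-mono i j = trans (colour i) (sym (colour j))
      where colour = X∈ys (Allₚ.all-filter _ segment)

gap-inequality : ∀ a b c → 2 * a ≤ c + b → 2 * (a ∸ b) ≤ c ∸ b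
gap-inequality a b c 2a≤c+b with ≤-total b a
... | inj₂ a≤b rewrite m≤n⇒m∸n≡0 a≤b = z≤n
... | inj₁ b≤a = m+n≤o⇒m≤o∸n (2 * (a ∸ b)) (+-cancelʳ-≤ b _ _ (begin
  2 * (a ∸ b) + b + b ≡⟨ solve 2 (λ d b → con 2 :* d :+ b :+ b := con 2 :* (d :+ b)) refl (a ∸ b) b ⟩
  2 * (a ∸ b + b)     ≡⟨ cong (2 *_) (m∸n+n≡m b≤a) ⟩
  2 * a               ≤⟨ 2a≤c+b ⟩
  c + b               ∎))
  where
    open ≤-Reasoning
    open +-*-Solver

separated-pair : ∀ {k t} (X Y : Fin (suc k) → ℕ) → (∀ i → X i ∈[ 1 , t + 1 ]) →
                 t + 2 ≤ Y fzero → t + t + 1 ≤ Y (fromℕ k) →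
                 X (fromℕ k) < Y fzero × 2 * (X (fromℕ k) ∸ X fzero) ≤ Y (fromℕ k) ∸ X fzero
separated-pair {k} {t} X Y X-bounded t+2≤y₁ t+t+1≤yₘ =
  X≺Y , gap-inequality (X (fromℕ k)) (X fzero) (Y (fromℕ k)) 2xₘ≤yₘ+x₁
  where
    open ≤-Reasoning
    open +-*-Solver
    xₘ≤t+1 = Σ.proj₂ (X-bounded (fromℕ k))

    X≺Y : X (fromℕ k) < Y fzero
    X≺Y = begin-strict
      X (fromℕ k) ≤⟨ xₘ≤t+1 ⟩
      t + 1       <⟨ +-monoʳ-< t ≤-refl ⟩
      t + 2       ≤⟨ t+2≤y₁ ⟩
      Y fzero     ∎

    2xₘ≤yₘ+x₁ : 2 * X (fromℕ k) ≤ Y (fromℕ k) + X fzero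
    2xₘ≤yₘ+x₁ = begin
      2 * X (fromℕ k)         ≤⟨ *-monoʳ-≤ 2 xₘ≤t+1 ⟩
      2 * (t + 1)             ≡⟨ solve 1 (λ t → con 2 :* (t :+ con 1) := t :+ t :+ con 1 :+ con 1) refl t ⟩
      t + t + 1 + 1           ≤⟨ +-mono-≤ t+t+1≤yₘ (Σ.proj₁ (X-bounded fzero)) ⟩
      Y (fromℕ k) + X fzero   ∎

-- The paper's intervals for t = r(m − 1): I₁ = [1, t + 1], I₂ = [t + 2, 2t], I₃ = [2t + 1, s],
-- inside S = [1, s].
module Intervals {t s : ℕ} (1≤t : 1 ≤ t) (t+t<s : t + t < s) where

  open ≤-Reasoning

  t+1≤s : t + 1 ≤ s
  t+1≤s = begin
    t + 1       ≤⟨ +-monoˡ-≤ 1 (m≤m+n t t) ⟩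
    t + t + 1   ≡⟨ +-comm (t + t) 1 ⟩
    suc (t + t) ≤⟨ t+t<s ⟩
    s           ∎

  I₁⊆S : ∀ {x} → x ∈[ 1 , t + 1 ] → x ∈[ 1 , s ]
  I₁⊆S = Σ.map₂ (λ x≤t+1 → ≤-trans x≤t+1 t+1≤s)

  I₂∪I₃-min : ∀ {y} → y ∈[ t + 2 , t + t ] ⊎ y ∈[ t + t + 1 , s ] → t + 2 ≤ y
  I₂∪I₃-min (inj₁ (t+2≤y , _))   = t+2≤y
  I₂∪I₃-min (inj₂ (t+t+1≤y , _)) = begin
    t + 2     ≡⟨ +-assoc t 1 1 ⟨
    t + 1 + 1 ≤⟨ +-monoˡ-≤ 1 (+-monoʳ-≤ t 1≤t) ⟩
    t + t + 1 ≤⟨ t+t+1≤y ⟩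
    _         ∎

  I₂∪I₃⊆S : ∀ {y} → y ∈[ t + 2 , t + t ] ⊎ y ∈[ t + t + 1 , s ] → y ∈[ 1 , s ]
  I₂∪I₃⊆S y∈I = ≤-trans (≤-trans (s≤s z≤n) (m≤n+m 2 t)) (I₂∪I₃-min y∈I)
              , [ (λ (_ , y≤t+t) → ≤-trans y≤t+t (<⇒≤ t+t<s)) , Σ.proj₂ ]′ y∈I

proposition2p1 : (m r s : ℕ) → 2 ≤ m → 1 ≤ r → 1 ≤ s →
    suc (2 * r * (m ∸ 1)) ≤ s →
    (Δ : ℕ → ℕ) → IsColoring r (λ x → x ∈[ 1 , s ]) Δ →
    (Σ (Fin m → ℕ) λ Y →
       IsMSet m Y ×
       SubsetOf m Y (λ y → y ∈[ r * (m ∸ 1) + 2 , 2 * r * (m ∸ 1) ] ⊎ y ∈[ 2 * r * (m ∸ 1) + 1 , s ]) ×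
       Monochromatic m Δ Y ×
       last m Y ∈[ 2 * r * (m ∸ 1) + 1 , s ]) →
    ¬ IsLColoring m r (λ x → x ∈[ 1 , s ]) Δ
proposition2p1 (suc k) r s (s≤s 1≤k) 1≤r _ 2rk<s Δ colouring
  (Y , Y-mset , Y⊆I₂∪I₃ , Y-mono , (2rk+1≤yₘ , _)) (_ , no-pair)
  -- generalising 2 * r * k turns every occurrence of 2r(m − 1) in the hypotheses into t + t
  with 2 * r * k | solve 2 (λ r k → con 2 :* r :* k := r :* k :+ r :* k) refl r k
  where open +-*-Solver
... | _ | refl =
  let X , X-mset , X-bounded , X-mono = monochromatic-mset r k Δ (λ x → colouring x ∘ I₁⊆S)
      X≺Y , gap = separated-pair X Y X-bounded (I₂∪I₃-min (Y⊆I₂∪I₃ fzero)) 2rk+1≤yₘ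
  in no-pair (X , Y , X-mset , Y-mset , I₁⊆S ∘ X-bounded , I₂∪I₃⊆S ∘ Y⊆I₂∪I₃ , X-mono , Y-mono , X≺Y , gap)
  where open Intervals (*-mono-≤ 1≤r 1≤k) 2rk<s
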